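{- Let $s, e \in \mathbf{N}$, let $n = 2s+e$, and let $M_{\mathrm{start}}$ be the multiset containing $1$ with multiplicity $n$. Then for every $b \in \mathbf{N}$ with $b \le n$, \[ \delta^{(b)}_e(M_{\mathrm{start}}) = (-1)^s \binom{n-b}{s}. \]
   Context: A position is a finite multiset of non-negative integers, regarded as an indexed family $(m_i)_{i\in I}$; a subposition $N$ of $M$ is the subfamily indexed by a subset of $I$ (distinct index subsets count as distinct subpositions), $\bar N$ is its complement, and $\Sigma(N)$ is the sum of the elements of $N$. Set $\epsilon_M(N) = \Sigma(\bar N) - \Sigma(N)$. For $e \in \mathbf{N}$ with $e \equiv \Sigma(M) \pmod 2$ define $\delta_e(M) = \sum_N (-1)^{\Sigma(N)}$, summed over subpositions $N$ of $M$ with $\epsilon_M(N) \ge e$. Define $\delta^{(1)}_e(M) = \delta_e(M)$ and, for $b \ge 2$, recursively $\delta^{(b)}_e(M) = \sum_{t \in \mathbf{N}_0} \delta^{(b-1)}_{e+2t}(M)$ (a finite sum, since terms with $e+2t > \Sigma(M)$ vanish). -}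

module Defs where

open import Data.Nat as ℕ using (ℕ; zero; suc; _+_; _*_; pred)
open import Data.List using (List; []; _∷_; map; _++_; upTo; replicate)
open import Data.Nat.ListAction using (sum)
open import Data.Product using (_×_; _,_)
open import Data.Integer as ℤ using (ℤ; +_; -_; _-_)
open import Relation.Nullary using (does)
open import Data.Bool using (if_then_else_)

-- A position: a finite indexed family of naturals, represented as a list
-- (the index set is the set of list positions).
Position : Set
Position = List ℕ

-- All subpositions N of M, each paired with its complement N̄.
-- One entry per subset of the index set (so distinct index subsets with
-- equal values are counted separately).
subpositions : Position → List (Position × Position)
subpositions [] = ([] , []) ∷ []
subpositions (m ∷ M) =
  map (λ { (N , Nc) → (m ∷ N , Nc) }) (subpositions M)
  ++ map (λ { (N , Nc) → (N , m ∷ Nc) }) (subpositions M)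

Σ : Position → ℕ
Σ = sum

ε : Position × Position → ℤ
ε (N , Nc) = + Σ Nc - + Σ N

sgn : ℕ → ℤ
sgn zero = + 1
sgn (suc k) = - sgn k

sumℤ : List ℤ → ℤ
sumℤ [] = + 0
sumℤ (x ∷ xs) = x ℤ.+ sumℤ xs

δ : ℕ → Position → ℤ
δ e M = sumℤ (map term (subpositions M))
  where
  term : Position × Position → ℤ
  term p@(N , _) = if does (+ e ℤ.≤? ε p) then sgn (Σ N) else + 0

-- iterate k e M = δ^{(k+1)}_e(M)
iterate : ℕ → ℕ → Position → ℤ
iterate zero e M = δ e M
iterate (suc k) e M = sumℤ (map (λ t → iterate k (e + 2 * t) M) (upTo (suc (Σ M))))
-- (terms with t > Σ(M) have e + 2t > Σ(M) and vanish, so the sum over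
--  t = 0 .. Σ(M) equals the sum over all t ∈ ℕ₀.)

-- δ^{(b)}_e(M), meaningful for b ≥ 1
δ^ : ℕ → ℕ → Position → ℤ
δ^ b = iterate (pred b)

Mstart : ℕ → Position
Mstart n = replicate n 1

-- Putting a new 1 into N or into N̄ shifts ε by ∓1, so with an integer threshold
-- δ_e(1 ∷ M) = δ_{e-1}(M) - δ_{e+1}(M). Since δ_e(1ⁿ) = 0 for e > n, Pascal's rule
-- gives δ_e(1ⁿ⁺¹) = (-1)ˢ C(n,s) whenever e + 2s = n + 1. One more summation turns
-- Σ_{t ≤ s} (-1)^(s-t) C(m+1, s-t) into (-1)ˢ C(m,s), again by Pascal's rule, so
-- every level of iteration lowers the upper binomial index by one.
module Submission where

open import Defs
open import Data.Nat using (ℕ; _+_; _*_; _∸_; _≤_)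
open import Data.Nat.Combinatorics using (_C_)
open import Data.Integer using (ℤ; +_) renaming (_*_ to _*ℤ_)
open import Relation.Binary.PropositionalEquality using (_≡_)

open import Data.Nat using (zero; suc; _<_; z≤n; s≤s)
import Data.Nat.Properties as ℕₚ
open import Data.Nat.Combinatorics using (nCk+nC[k+1]≡[n+1]C[k+1])
import Data.Nat.Tactic.RingSolver as ℕ-Solver
import Data.Integer as ℤ
import Data.Integer.Properties as ℤₚ
open import Data.Integer.Tactic.RingSolver using (solve-∀)
open import Data.List using (List; []; _∷_; map; _++_; applyUpTo)
open import Data.List.Properties using (map-++; map-∘; map-upTo)
open import Data.Product using (_×_; _,_)
open import Data.Bool using (if_then_else_)
open import Data.Bool.Properties using (if-float)
open import Function using (_⇔_; mk⇔)
open import Relation.Nullary using (does)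
open import Relation.Nullary.Decidable using (does-⇔; dec-true; dec-false)
open import Relation.Binary.PropositionalEquality
  using (refl; sym; trans; cong; cong₂; subst₂; module ≡-Reasoning)

signed : ℕ → ℕ → ℤ
signed n s = sgn s *ℤ + (n C s)

signed-pascal : ∀ n s → signed (suc n) (suc s) ≡ ℤ.- signed n s ℤ.+ signed n (suc s)
signed-pascal n s = begin
  ℤ.- sgn s *ℤ + (suc n C suc s)
    ≡⟨ cong (λ c → ℤ.- sgn s *ℤ + c) (sym (nCk+nC[k+1]≡[n+1]C[k+1] n s)) ⟩
  ℤ.- sgn s *ℤ (+ (n C s) ℤ.+ + (n C suc s))
    ≡⟨ distrib (sgn s) (+ (n C s)) (+ (n C suc s)) ⟩
  ℤ.- (sgn s *ℤ + (n C s)) ℤ.+ ℤ.- sgn s *ℤ + (n C suc s) ∎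
  where
  open ≡-Reasoning
  distrib : ∀ x a b → ℤ.- x *ℤ (a ℤ.+ b) ≡ ℤ.- (x *ℤ a) ℤ.+ ℤ.- x *ℤ b
  distrib = solve-∀

sumℤ-++ : ∀ xs ys → sumℤ (xs ++ ys) ≡ sumℤ xs ℤ.+ sumℤ ys
sumℤ-++ []       ys = sym (ℤₚ.+-identityˡ (sumℤ ys))
sumℤ-++ (x ∷ xs) ys =
  trans (cong (ℤ._+_ x) (sumℤ-++ xs ys)) (sym (ℤₚ.+-assoc x (sumℤ xs) (sumℤ ys)))

sumℤ-map-cong : ∀ {A : Set} {f g : A → ℤ} → (∀ x → f x ≡ g x) → ∀ xs →
  sumℤ (map f xs) ≡ sumℤ (map g xs)
sumℤ-map-cong f≗g []       = refl
sumℤ-map-cong f≗g (x ∷ xs) = cong₂ ℤ._+_ (f≗g x) (sumℤ-map-cong f≗g xs)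

sumℤ-map-neg : ∀ {A : Set} (f : A → ℤ) xs →
  sumℤ (map (λ x → ℤ.- f x) xs) ≡ ℤ.- sumℤ (map f xs)
sumℤ-map-neg f []       = refl
sumℤ-map-neg f (x ∷ xs) =
  trans (cong (ℤ._+_ (ℤ.- f x)) (sumℤ-map-neg f xs))
        (sym (ℤₚ.neg-distrib-+ (f x) (sumℤ (map f xs))))

sumℤ-applyUpTo-zero : ∀ {f : ℕ → ℤ} → (∀ t → f t ≡ + 0) → ∀ L →
  sumℤ (applyUpTo f L) ≡ + 0
sumℤ-applyUpTo-zero f≗0 zero    = refl
sumℤ-applyUpTo-zero f≗0 (suc L) =
  cong₂ ℤ._+_ (f≗0 0) (sumℤ-applyUpTo-zero (λ t → f≗0 (suc t)) L)

applyUpTo-cong : ∀ {A : Set} {f g : ℕ → A} → (∀ t → f t ≡ g t) → ∀ L →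
  applyUpTo f L ≡ applyUpTo g L
applyUpTo-cong f≗g zero    = refl
applyUpTo-cong f≗g (suc L) = cong₂ _∷_ (f≗g 0) (applyUpTo-cong (λ t → f≗g (suc t)) L)

+-cancelʳ-≤ : ∀ k {i j} → i ℤ.+ k ℤ.≤ j ℤ.+ k → i ℤ.≤ j
+-cancelʳ-≤ k {i} {j} le = subst₂ ℤ._≤_ (cancel i k) (cancel j k) (ℤₚ.+-monoˡ-≤ (ℤ.- k) le)
  where
  cancel : ∀ x y → x ℤ.+ y ℤ.- y ≡ x
  cancel = solve-∀

≤-shift-⇔ : ∀ k {e x y} → x ℤ.+ k ≡ y → e ℤ.≤ x ⇔ e ℤ.+ k ℤ.≤ y
≤-shift-⇔ k refl = mk⇔ (ℤₚ.+-monoˡ-≤ k) (+-cancelʳ-≤ k)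

-- δ with an integer threshold, which the recurrence for 1 ∷ M pushes below zero;
-- δ e M and δℤ (+ e) M are definitionally equal.
δ-term : ℤ → Position × Position → ℤ
δ-term e (N , Nc) = if does (e ℤ.≤? ε (N , Nc)) then sgn (Σ N) else + 0

δℤ : ℤ → Position → ℤ
δℤ e M = sumℤ (map (δ-term e) (subpositions M))

ε-1∷-sub : ∀ N Nc → ε (1 ∷ N , Nc) ℤ.+ + 1 ≡ ε (N , Nc)
ε-1∷-sub N Nc = shift (+ Σ Nc) (+ Σ N)
  where
  shift : ∀ x y → x ℤ.- (+ 1 ℤ.+ y) ℤ.+ + 1 ≡ x ℤ.- y
  shift = solve-∀

ε-1∷-complement : ∀ N Nc → ε (N , 1 ∷ Nc) ℤ.- + 1 ≡ ε (N , Nc)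
ε-1∷-complement N Nc = shift (+ Σ Nc) (+ Σ N)
  where
  shift : ∀ x y → (+ 1 ℤ.+ x) ℤ.- y ℤ.- + 1 ≡ x ℤ.- y
  shift = solve-∀

δ-term-1∷-sub : ∀ e N Nc → δ-term e (1 ∷ N , Nc) ≡ ℤ.- δ-term (e ℤ.+ + 1) (N , Nc)
δ-term-1∷-sub e N Nc = begin
  (if does (e ℤ.≤? ε (1 ∷ N , Nc)) then ℤ.- sgn (Σ N) else + 0)
    ≡⟨ cong (if_then ℤ.- sgn (Σ N) else + 0)
            (does-⇔ (≤-shift-⇔ (+ 1) (ε-1∷-sub N Nc)) (e ℤ.≤? _) (e ℤ.+ + 1 ℤ.≤? _)) ⟩
  (if does (e ℤ.+ + 1 ℤ.≤? ε (N , Nc)) then ℤ.- sgn (Σ N) else + 0)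
    ≡⟨ sym (if-float ℤ.-_ (does (e ℤ.+ + 1 ℤ.≤? ε (N , Nc)))) ⟩
  ℤ.- δ-term (e ℤ.+ + 1) (N , Nc) ∎
  where open ≡-Reasoning

δ-term-1∷-complement : ∀ e N Nc → δ-term e (N , 1 ∷ Nc) ≡ δ-term (e ℤ.- + 1) (N , Nc)
δ-term-1∷-complement e N Nc = cong (if_then sgn (Σ N) else + 0)
  (does-⇔ (≤-shift-⇔ (ℤ.- + 1) (ε-1∷-complement N Nc)) (e ℤ.≤? _) (e ℤ.- + 1 ℤ.≤? _))

δℤ-1∷ : ∀ e M → δℤ e (1 ∷ M) ≡ ℤ.- δℤ (e ℤ.+ + 1) M ℤ.+ δℤ (e ℤ.- + 1) M
δℤ-1∷ e M = begin
  sumℤ (map (δ-term e) (map into-sub S ++ map into-complement S))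
    ≡⟨ cong sumℤ (map-++ (δ-term e) (map into-sub S) (map into-complement S)) ⟩
  sumℤ (map (δ-term e) (map into-sub S) ++ map (δ-term e) (map into-complement S))
    ≡⟨ sumℤ-++ (map (δ-term e) (map into-sub S)) _ ⟩
  sumℤ (map (δ-term e) (map into-sub S)) ℤ.+ sumℤ (map (δ-term e) (map into-complement S))
    ≡⟨ cong₂ ℤ._+_ (cong sumℤ (sym (map-∘ S))) (cong sumℤ (sym (map-∘ S))) ⟩
  sumℤ (map (λ p → δ-term e (into-sub p)) S) ℤ.+ sumℤ (map (λ p → δ-term e (into-complement p)) S)
    ≡⟨ cong₂ ℤ._+_ (sumℤ-map-cong (λ { (N , Nc) → δ-term-1∷-sub e N Nc }) S)
                   (sumℤ-map-cong (λ { (N , Nc) → δ-term-1∷-complement e N Nc }) S) ⟩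
  sumℤ (map (λ p → ℤ.- δ-term (e ℤ.+ + 1) p) S) ℤ.+ δℤ (e ℤ.- + 1) M
    ≡⟨ cong (ℤ._+ δℤ (e ℤ.- + 1) M) (sumℤ-map-neg (δ-term (e ℤ.+ + 1)) S) ⟩
  ℤ.- δℤ (e ℤ.+ + 1) M ℤ.+ δℤ (e ℤ.- + 1) M ∎
  where
  open ≡-Reasoning
  S : List (Position × Position)
  S = subpositions M
  into-sub into-complement : Position × Position → Position × Position
  into-sub (N , Nc) = (1 ∷ N , Nc)
  into-complement (N , Nc) = (N , 1 ∷ Nc)

δℤ-[]-nonpos : ∀ {e} → e ℤ.≤ + 0 → δℤ e [] ≡ + 1
δℤ-[]-nonpos {e} e≤0 = cong (λ b → (if b then + 1 else + 0) ℤ.+ + 0)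
  (dec-true (e ℤ.≤? + 0) e≤0)

δℤ-[]-pos : ∀ {e} → + 1 ℤ.≤ e → δℤ e [] ≡ + 0
δℤ-[]-pos {e} 1≤e = cong (λ b → (if b then + 1 else + 0) ℤ.+ + 0)
  (dec-false (e ℤ.≤? + 0) (λ e≤0 → ℤₚ.<⇒≱ (ℤ.+<+ (s≤s z≤n)) (ℤₚ.≤-trans 1≤e e≤0)))

i-1≤i+1 : ∀ i → i ℤ.- + 1 ℤ.≤ i ℤ.+ + 1
i-1≤i+1 i = ℤₚ.+-monoʳ-≤ i ℤ.-≤+

δℤ-Mstart-vanish : ∀ n {e} → + suc n ℤ.≤ e → δℤ e (Mstart n) ≡ + 0
δℤ-Mstart-vanish zero    1≤e = δℤ-[]-pos 1≤e
δℤ-Mstart-vanish (suc n) {e} n+1<e = begin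
  δℤ e (1 ∷ Mstart n)
    ≡⟨ δℤ-1∷ e (Mstart n) ⟩
  ℤ.- δℤ (e ℤ.+ + 1) (Mstart n) ℤ.+ δℤ (e ℤ.- + 1) (Mstart n)
    ≡⟨ cong₂ (λ a b → ℤ.- a ℤ.+ b) (δℤ-Mstart-vanish n (ℤₚ.≤-trans n<e-1 (i-1≤i+1 e)))
                                   (δℤ-Mstart-vanish n n<e-1) ⟩
  + 0 ∎
  where
  open ≡-Reasoning
  n<e-1 : + suc n ℤ.≤ e ℤ.- + 1
  n<e-1 = ℤₚ.+-monoˡ-≤ (ℤ.- + 1) n+1<e

δℤ-Mstart : ∀ n s e → e ℤ.+ + (s + s) ≡ + suc n → δℤ e (Mstart (suc n)) ≡ signed n s
δℤ-Mstart zero zero e e+0≡1 with trans (sym (ℤₚ.+-identityʳ e)) e+0≡1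
... | refl = refl
δℤ-Mstart zero (suc s) e e+2s≡1 = begin
  δℤ e (1 ∷ [])
    ≡⟨ δℤ-1∷ e [] ⟩
  ℤ.- δℤ (e ℤ.+ + 1) [] ℤ.+ δℤ (e ℤ.- + 1) []
    ≡⟨ cong₂ (λ a b → ℤ.- a ℤ.+ b) (δℤ-[]-nonpos e+1≤0)
                                   (δℤ-[]-nonpos (ℤₚ.≤-trans (i-1≤i+1 e) e+1≤0)) ⟩
  + 0
    ≡⟨ sym (ℤₚ.*-zeroʳ (sgn (suc s))) ⟩
  signed 0 (suc s) ∎
  where
  open ≡-Reasoning
  e+1≤0 : e ℤ.+ + 1 ℤ.≤ + 0
  e+1≤0 = +-cancelʳ-≤ (+ 1) (subst₂ ℤ._≤_ (sym (ℤₚ.+-assoc e (+ 1) (+ 1))) e+2s≡1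
            (ℤₚ.+-monoʳ-≤ e (ℤ.+≤+ (ℕₚ.+-mono-≤ (s≤s z≤n) (s≤s z≤n)))))
δℤ-Mstart (suc n) zero e e+0≡n+2 = begin
  δℤ e (1 ∷ Mstart (suc n))
    ≡⟨ δℤ-1∷ e (Mstart (suc n)) ⟩
  ℤ.- δℤ (e ℤ.+ + 1) (Mstart (suc n)) ℤ.+ δℤ (e ℤ.- + 1) (Mstart (suc n))
    ≡⟨ cong₂ (λ a b → ℤ.- a ℤ.+ b) (δℤ-Mstart-vanish (suc n) n+1<e+1)
                                   (δℤ-Mstart n zero (e ℤ.- + 1) (lower-threshold e+0≡n+2)) ⟩
  signed (suc n) zero ∎
  where
  open ≡-Reasoning
  n+1<e+1 : + suc (suc n) ℤ.≤ e ℤ.+ + 1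
  n+1<e+1 = subst₂ ℤ._≤_ (trans (sym (ℤₚ.+-identityʳ e)) e+0≡n+2) refl (ℤₚ.i≤i+j e (+ 1))
  lower-threshold : e ℤ.+ + 0 ≡ + suc (suc n) → e ℤ.- + 1 ℤ.+ + 0 ≡ + suc n
  lower-threshold h = trans (swap e (+ 0)) (cong (ℤ._+ ℤ.- + 1) h)
    where
    swap : ∀ x y → x ℤ.- + 1 ℤ.+ y ≡ x ℤ.+ y ℤ.- + 1
    swap = solve-∀
δℤ-Mstart (suc n) (suc s) e e+2s≡n+2 = begin
  δℤ e (1 ∷ Mstart (suc n))
    ≡⟨ δℤ-1∷ e (Mstart (suc n)) ⟩
  ℤ.- δℤ (e ℤ.+ + 1) (Mstart (suc n)) ℤ.+ δℤ (e ℤ.- + 1) (Mstart (suc n))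
    ≡⟨ cong₂ (λ a b → ℤ.- a ℤ.+ b) (δℤ-Mstart n s (e ℤ.+ + 1) raised)
                                   (δℤ-Mstart n (suc s) (e ℤ.- + 1) lowered) ⟩
  ℤ.- signed n s ℤ.+ signed n (suc s)
    ≡⟨ sym (signed-pascal n s) ⟩
  signed (suc n) (suc s) ∎
  where
  open ≡-Reasoning
  raised : e ℤ.+ + 1 ℤ.+ + (s + s) ≡ + suc n
  raised = trans (shift e (+ s)) (cong (ℤ._+ ℤ.- + 1) e+2s≡n+2)
    where
    shift : ∀ x y → x ℤ.+ + 1 ℤ.+ (y ℤ.+ y) ≡ x ℤ.+ ((+ 1 ℤ.+ y) ℤ.+ (+ 1 ℤ.+ y)) ℤ.- + 1
    shift = solve-∀
  lowered : e ℤ.- + 1 ℤ.+ + (suc s + suc s) ≡ + suc n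
  lowered = trans (shift e (+ (suc s + suc s))) (cong (ℤ._+ ℤ.- + 1) e+2s≡n+2)
    where
    shift : ∀ x y → x ℤ.- + 1 ℤ.+ y ≡ x ℤ.+ y ℤ.- + 1
    shift = solve-∀

Σ-Mstart : ∀ n → Σ (Mstart n) ≡ n
Σ-Mstart zero    = refl
Σ-Mstart (suc n) = cong suc (Σ-Mstart n)

iterate-suc-Mstart : ∀ k e N → iterate (suc k) e (Mstart N) ≡
  sumℤ (applyUpTo (λ t → iterate k (e + 2 * t) (Mstart N)) (suc N))
iterate-suc-Mstart k e N rewrite Σ-Mstart N =
  cong sumℤ (map-upTo (λ t → iterate k (e + 2 * t) (Mstart N)) (suc N))

iterate-Mstart-vanish : ∀ k N {e} → N < e → iterate k e (Mstart N) ≡ + 0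
iterate-Mstart-vanish zero    N     N<e = δℤ-Mstart-vanish N (ℤ.+≤+ N<e)
iterate-Mstart-vanish (suc k) N {e} N<e = trans (iterate-suc-Mstart k e N)
  (sumℤ-applyUpTo-zero
    (λ t → iterate-Mstart-vanish k N (ℕₚ.<-≤-trans N<e (ℕₚ.m≤m+n e (2 * t)))) (suc N))

module _ (F : ℕ → ℤ) (N m : ℕ)
         (F-on-parity : ∀ x s → x + (s + s) ≡ N → F x ≡ signed (suc m) s)
         (F-above : ∀ x → N < x → F x ≡ + 0)
         where

  sumℤ-stride-two-signed : ∀ s L e → s ≤ L → e + (s + s) ≡ N →
    sumℤ (applyUpTo (λ t → F (e + 2 * t)) (suc L)) ≡ signed m s
  sumℤ-stride-two-signed zero L e _ e+0≡N =
    cong₂ ℤ._+_ (F-on-parity (e + 0) 0 (trans (ℕₚ.+-identityʳ (e + 0)) e+0≡N))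
                (sumℤ-applyUpTo-zero (λ t → F-above (e + 2 * suc t) (N<e+2[1+t] t)) L)
    where
    N<e+2[1+t] : ∀ t → N < e + 2 * suc t
    N<e+2[1+t] t = subst₂ _<_ e+0≡N refl (ℕₚ.+-monoʳ-< e (s≤s z≤n))
  sumℤ-stride-two-signed (suc s) (suc L) e 1+s≤1+L e+2s≡N = begin
    F (e + 0) ℤ.+ sumℤ (applyUpTo (λ t → F (e + 2 * suc t)) (suc L))
      ≡⟨ cong₂ ℤ._+_ (F-on-parity (e + 0) (suc s)
                       (trans (cong (_+ (suc s + suc s)) (ℕₚ.+-identityʳ e)) e+2s≡N))
                     (cong sumℤ (applyUpTo-cong (λ t → cong F (stride e t)) (suc L))) ⟩
    signed (suc m) (suc s) ℤ.+ sumℤ (applyUpTo (λ t → F (e + 2 + 2 * t)) (suc L))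
      ≡⟨ cong (ℤ._+_ (signed (suc m) (suc s)))
              (sumℤ-stride-two-signed s L (e + 2) (ℕₚ.≤-pred 1+s≤1+L)
                                      (trans (regroup e s) e+2s≡N)) ⟩
    signed (suc m) (suc s) ℤ.+ signed m s
      ≡⟨ cong (ℤ._+ signed m s) (signed-pascal m s) ⟩
    ℤ.- signed m s ℤ.+ signed m (suc s) ℤ.+ signed m s
      ≡⟨ cancel (signed m s) (signed m (suc s)) ⟩
    signed m (suc s) ∎
    where
    open ≡-Reasoning
    stride : ∀ e t → e + 2 * suc t ≡ e + 2 + 2 * t
    stride = ℕ-Solver.solve-∀
    regroup : ∀ e s → e + 2 + (s + s) ≡ e + (suc s + suc s)
    regroup = ℕ-Solver.solve-∀
    cancel : ∀ a b → ℤ.- a ℤ.+ b ℤ.+ a ≡ b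
    cancel = solve-∀

iterate-Mstart : ∀ k m N e s → N ≡ suc (k + m) → e + (s + s) ≡ N →
  iterate k e (Mstart N) ≡ signed m s
iterate-Mstart zero    m N e s refl e+2s≡N = δℤ-Mstart m s (+ e) (cong +_ e+2s≡N)
iterate-Mstart (suc k) m N e s N≡k+m+2 e+2s≡N = trans (iterate-suc-Mstart k e N)
  (sumℤ-stride-two-signed (λ x → iterate k x (Mstart N)) N m
    (λ x s′ → iterate-Mstart k (suc m) N x s′ (trans N≡k+m+2 (cong suc (sym (ℕₚ.+-suc k m)))))
    (λ x → iterate-Mstart-vanish k N)
    s N e s≤N e+2s≡N)
  where
  s≤N : s ≤ N
  s≤N = ℕₚ.≤-trans (ℕₚ.m≤m+n s s) (subst₂ _≤_ refl e+2s≡N (ℕₚ.m≤n+m (s + s) e))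

lemma4 : (s e b : ℕ) → 1 ≤ s → 1 ≤ e → 1 ≤ b → b ≤ 2 * s + e →
    δ^ b e (Mstart (2 * s + e)) ≡ sgn s *ℤ + ((2 * s + e ∸ b) C s)
lemma4 s e (suc k) _ _ _ b≤n =
  iterate-Mstart k (2 * s + e ∸ suc k) (2 * s + e) e s (sym (ℕₚ.m+[n∸m]≡n b≤n)) (e+2s≡n s e)
  where
  e+2s≡n : ∀ s e → e + (s + s) ≡ 2 * s + e
  e+2s≡n = ℕ-Solver.solve-∀
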